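{- For all integers $i,j,k\ge 0$: $\mu_{\rm t}(G_7^{(i,j,k)})=i+j+k$; $\mu_{\rm o}(G_7^{(i,j,k)})=i+j+k+3$; $\mu_{\rm d}(G_7^{(i,j,k)})=3$ if $i+j+k=0$ and $\mu_{\rm d}(G_7^{(i,j,k)})=i+j+k+2$ if $i+j+k\ge 1$; and $\mu(G_7^{(i,j,k)})=i+j+k+4$.
   Context: $G_7$ is the graph with vertices $a_1,a_2,a_3,b_1,b_2,b_3,c$, where $a_1a_2a_3$ is a triangle, $a_\ell b_\ell$ is an edge for $\ell=1,2,3$, and $c$ is adjacent to $b_1,b_2,b_3$. $G_7^{(i,j,k)}$ is obtained from $G_7$ by adding $i$ new vertices each adjacent exactly to $a_1$ and $c$, $j$ new vertices each adjacent exactly to $a_2$ and $c$, and $k$ new vertices each adjacent exactly to $a_3$ and $c$ (i.e., duplicating the degree-2 vertices $b_1,b_2,b_3$ $i$, $j$, $k$ times). For a connected graph $G$ and $X\subseteq V(G)$, two vertices are $X$-visible if there is a shortest path between them whose internal vertices are not in $X$. $X$ is: a mutual-visibility set if every two vertices of $X$ are $X$-visible; an outer mutual-visibility set if moreover every $x\in X$ and $y\notin X$ are $X$-visible; a dual mutual-visibility set if every two vertices of $X$ and every two vertices of $V(G)\setminus X$ are $X$-visible; a total mutual-visibility set if every two vertices of $G$ are $X$-visible. $\mu,\mu_{\rm o},\mu_{\rm d},\mu_{\rm t}$ denote the respective maximum cardinalities. -}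

module Defs where

open import Data.Nat using (ℕ; _+_; _≤_)
open import Data.Fin using (Fin; zero; suc; splitAt)
open import Data.Fin.Subset using (Subset; _∈_; _∉_; ∣_∣)
open import Data.List using (List; []; _∷_)
open import Data.List.Relation.Unary.All using (All)
open import Data.Product using (Σ; _×_; ∃)
open import Data.Sum using (_⊎_; inj₁; inj₂)
open import Data.Unit using (⊤)
open import Data.Empty using (⊥)
open import Relation.Binary.PropositionalEquality using (_≡_; _≢_)

module _ {n : ℕ} (E : Fin n → Fin n → Set) where

  data Walk : Fin n → Fin n → Set where
    [] : ∀ {u} → Walk u u
    _∷_ : ∀ {u w v} → E u w → Walk w v → Walk u v

  len : ∀ {u v} → Walk u v → ℕ
  len [] = 0
  len (_ ∷ p) = Data.Nat.suc (len p)

  inner : ∀ {u v} → Walk u v → List (Fin n)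
  inner [] = []
  inner (_ ∷ []) = []
  inner (_∷_ {w = w} _ p@(_ ∷ _)) = w ∷ inner p

  IsShortest : ∀ {u v} → Walk u v → Set
  IsShortest {u} {v} p = (q : Walk u v) → len p ≤ len q

  Visible : Subset n → Fin n → Fin n → Set
  Visible X u v = Σ (Walk u v) λ p → IsShortest p × All (λ w → w ∉ X) (inner p)

  MutualVis : Subset n → Set
  MutualVis X = ∀ u v → u ∈ X → v ∈ X → Visible X u v

  OuterMutualVis : Subset n → Set
  OuterMutualVis X = MutualVis X × (∀ u v → u ∈ X → v ∉ X → Visible X u v)

  DualMutualVis : Subset n → Set
  DualMutualVis X = MutualVis X × (∀ u v → u ∉ X → v ∉ X → Visible X u v)

  TotalMutualVis : Subset n → Set
  TotalMutualVis X = ∀ u v → Visible X u v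

IsMaxCard : ∀ {n} → (Subset n → Set) → ℕ → Set
IsMaxCard {n} P m = (Σ (Subset n) λ X → P X × ∣ X ∣ ≡ m) × (∀ X → P X → ∣ X ∣ ≤ m)

-- vertex kinds: a ℓ (ℓ = 1,2,3 as 0,1,2), b ℓ (b_ℓ and its copies), c
data Kind : Set where
  a : Fin 3 → Kind
  b : Fin 3 → Kind
  c : Kind

KAdj : Kind → Kind → Set
KAdj (a ℓ) (a ℓ') = ℓ ≢ ℓ'
KAdj (a ℓ) (b ℓ') = ℓ ≡ ℓ'
KAdj (b ℓ) (a ℓ') = ℓ ≡ ℓ'
KAdj (b _) c = ⊤
KAdj c (b _) = ⊤
KAdj _ _ = ⊥

baseKind : Fin 7 → Kind
baseKind zero = a zero
baseKind (suc zero) = a (suc zero)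
baseKind (suc (suc zero)) = a (suc (suc zero))
baseKind (suc (suc (suc zero))) = b zero
baseKind (suc (suc (suc (suc zero)))) = b (suc zero)
baseKind (suc (suc (suc (suc (suc zero))))) = b (suc (suc zero))
baseKind (suc (suc (suc (suc (suc (suc _)))))) = c

-- vertices 0..6: G₇; next i: copies of b₁; next j: copies of b₂; last k: copies of b₃
kind : (i j k : ℕ) → Fin (7 + i + j + k) → Kind
kind i j k x with splitAt (7 + i + j) x
... | inj₂ _ = b (suc (suc zero))
... | inj₁ y with splitAt (7 + i) y
...   | inj₂ _ = b (suc zero)
...   | inj₁ z with splitAt 7 z
...     | inj₂ _ = b zero
...     | inj₁ w = baseKind w

G7 : (i j k : ℕ) → Fin (7 + i + j + k) → Fin (7 + i + j + k) → Set
G7 i j k x y = KAdj (kind i j k x) (kind i j k y)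

-- G₇^(i,j,k) is G₇ with every vertex blown up into a class of pairwise non-adjacent twins
-- (only the classes of b₁, b₂, b₃ have more than one element), and any two of its vertices
-- are at distance at most 2.  Hence u and v are X-visible iff they are equal, adjacent, or
-- have a common neighbour outside X, and which kinds of vertices see each other depends only
-- on the set F of full kinds (those with all their vertices in X).  Each kind outside F
-- contributes its own vertex outside X, so |X| ≤ i + j + k + |F|, and an exhaustive check of
-- the 2⁷ possible F bounds |F| by 0, 3, 2 and 4 for the total, outer, dual and plain notions,
-- the only exception being the dual pattern F = {a₁, a₂, a₃}, which forces X ⊆ {a₁, a₂, a₃}.
-- The matching lower bounds are explicit sets, checked class by class.
module Submission where

open import Defs
open import Data.Bool using (Bool; _≟_; true; false; T; not; _∧_; _xor_)
open import Data.Empty using (⊥-elim)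
open import Data.Fin using (Fin; zero; suc; splitAt; _↑ˡ_; #_)
open import Data.Fin.Properties using (any?; all?; suc-injective; 0≢1+n; splitAt-↑ˡ; splitAt⁻¹-↑ˡ)
  renaming (_≟_ to _≟ᶠ_)
open import Data.Fin.Subset using (Subset; ⊤; _∈_; _∉_; ∣_∣; ∁; _-_; _⊆_; inside; outside)
open import Data.Fin.Subset.Properties
  using (_∈?_; anySubset?; ∣p∣≤n; ∣∁p∣≡n∸∣p∣; ∣⊤∣≡n; ∣⊥∣≡0; x∈p∧x≢y⇒x∈p-y; x∈p⇒∣p-x∣<∣p∣;
         p⊆q⇒∣p∣≤∣q∣; x∉p⇒x∈∁p; x∈∁p⇒x∉p)
open import Data.List.Relation.Unary.All using ([]; _∷_)
open import Data.Nat using (ℕ; suc; _+_; _≤_; _≤?_; z≤n; s≤s)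
open import Data.Nat.Properties
  using (≤-trans; ≤-reflexive; n≤1+n; +-monoʳ-≤; +-monoˡ-≤; +-cancelˡ-≤; +-assoc; +-comm; +-identityʳ;
         m+[n∸m]≡n; module ≤-Reasoning)
open import Data.Product using (Σ; ∃; _×_; _,_; proj₁; proj₂)
open import Data.Sum as Sum using (_⊎_; inj₁; inj₂; [_,_]′)
open import Data.Unit using (tt)
open import Data.Vec using ([]; _∷_; here; there; lookup; tabulate; replicate; _++_)
open import Data.Vec.Properties
  using (≡-dec; lookup⇒[]=; []=⇒lookup; lookup∘tabulate; tabulate∘lookup; lookup-splitAt; lookup-replicate)
open import Function using (_∘_; id; Injective)
open import Function.Bundles using (_⇔_; mk⇔; Equivalence)
open import Relation.Binary.PropositionalEquality
  using (_≡_; _≢_; refl; sym; trans; cong; cong₂; subst; subst₂; module ≡-Reasoning)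
open import Relation.Nullary using (¬_; Dec; yes; no; does; ¬?; contradiction)
open import Relation.Nullary.Decidable
  using (_×-dec_; _⊎-dec_; _→-dec_; T?; from-yes; map′; decidable-stable; dec-true)
open import Relation.Unary using (Pred; Decidable)

injective⇒∣p∣≤∣q∣ : ∀ {m n} (f : Fin m → Fin n) → Injective _≡_ _≡_ f →
                    ∀ {p q} → (∀ {x} → x ∈ p → f x ∈ q) → ∣ p ∣ ≤ ∣ q ∣
injective⇒∣p∣≤∣q∣ f f-inj {[]} _ = z≤n
injective⇒∣p∣≤∣q∣ f f-inj {outside ∷ p} f[p]⊆q =
  injective⇒∣p∣≤∣q∣ (f ∘ suc) (suc-injective ∘ f-inj) (f[p]⊆q ∘ there)
injective⇒∣p∣≤∣q∣ f f-inj {inside ∷ p} {q} f[p]⊆q = begin-strict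
  ∣ p ∣           ≤⟨ injective⇒∣p∣≤∣q∣ (f ∘ suc) (suc-injective ∘ f-inj) f[p]⊆q-f0 ⟩
  ∣ q - f zero ∣  <⟨ x∈p⇒∣p-x∣<∣p∣ (f[p]⊆q here) ⟩
  ∣ q ∣           ∎
  where
  open ≤-Reasoning
  f[p]⊆q-f0 : ∀ {x} → x ∈ p → f (suc x) ∈ q - f zero
  f[p]⊆q-f0 x∈p = x∈p∧x≢y⇒x∈p-y (f[p]⊆q (there x∈p)) (λ eq → 0≢1+n (sym (f-inj eq)))

∣p∣+∣∁p∣≡n : ∀ {n} (p : Subset n) → ∣ p ∣ + ∣ ∁ p ∣ ≡ n
∣p∣+∣∁p∣≡n p = trans (cong (∣ p ∣ +_) (∣∁p∣≡n∸∣p∣ p)) (m+[n∸m]≡n (∣p∣≤n p))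

∣p++q∣≡∣p∣+∣q∣ : ∀ {m n} (p : Subset m) (q : Subset n) → ∣ p ++ q ∣ ≡ ∣ p ∣ + ∣ q ∣
∣p++q∣≡∣p∣+∣q∣ []            q = refl
∣p++q∣≡∣p∣+∣q∣ (inside ∷ p)  q = cong suc (∣p++q∣≡∣p∣+∣q∣ p q)
∣p++q∣≡∣p∣+∣q∣ (outside ∷ p) q = ∣p++q∣≡∣p∣+∣q∣ p q

allSubsets? : ∀ {n ℓ} {P : Pred (Subset n) ℓ} → Decidable P → Dec (∀ p → P p)
allSubsets? P? = map′ (λ ∄¬P p → decidable-stable (P? p) (λ ¬Pp → ∄¬P (p , ¬Pp)))
                      (λ ∀P (p , ¬Pp) → ¬Pp (∀P p))
                      (¬? (anySubset? (¬? ∘ P?)))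

lookup≡false⇒∉ : ∀ {n} {X : Subset n} {x} → lookup X x ≡ false → x ∉ X
lookup≡false⇒∉ eq x∈X with () ← trans (sym ([]=⇒lookup x∈X)) eq

∉⇒lookup≡false : ∀ {n} {X : Subset n} {x} → x ∉ X → lookup X x ≡ false
∉⇒lookup≡false {X = X} {x} x∉X with lookup X x in eq
... | true  = contradiction (lookup⇒[]= x X eq) x∉X
... | false = refl

-- Visibility in graphs of diameter at most 2

-- Whether u and v must be X-visible, as a function of the membership of u and of v in X;
-- each of the four visibility notions is one such requirement.
Requirement : Set
Requirement = Bool → Bool → Bool

inIn inAny sameSide anyPair : Requirement
inIn         = _∧_
inAny    x _ = x
sameSide x y = not (x xor y)
anyPair  _ _ = true

module Visibility {n : ℕ} (E : Fin n → Fin n → Set) where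

  Visible≤2 : Subset n → Fin n → Fin n → Set
  Visible≤2 X u v = u ≡ v ⊎ E u v ⊎ ∃ λ w → E u w × E w v × w ∉ X

  visible⇒visible≤2 : (∀ u v → Σ (Walk E u v) λ p → len E p ≤ 2) →
                      ∀ {X u v} → Visible E X u v → Visible≤2 X u v
  visible⇒visible≤2 _ ([] , _) = inj₁ refl
  visible⇒visible≤2 _ ((e ∷ []) , _) = inj₂ (inj₁ e)
  visible⇒visible≤2 _ ((e ∷ e′ ∷ []) , _ , w∉X ∷ []) = inj₂ (inj₂ (_ , e , e′ , w∉X))
  visible⇒visible≤2 diameter≤2 {u = u} {v} ((_ ∷ _ ∷ _ ∷ _) , shortest , _)
    with ≤-trans (shortest (proj₁ (diameter≤2 u v))) (proj₂ (diameter≤2 u v))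
  ... | s≤s (s≤s ())

  module _ (irreflexive : ∀ u → ¬ E u u) (E? : ∀ u v → Dec (E u v)) where

    edge-shortest : ∀ {u v} (e : E u v) → IsShortest E (e ∷ [])
    edge-shortest {u} e []      = contradiction e (irreflexive u)
    edge-shortest     e (_ ∷ _) = s≤s z≤n

    path₂-shortest : ∀ {u v w} → u ≢ v → ¬ E u v → (e : E u w) (e′ : E w v) →
                     IsShortest E (e ∷ e′ ∷ [])
    path₂-shortest u≢v _   _ _ []          = contradiction refl u≢v
    path₂-shortest _   ¬uv _ _ (uv ∷ [])   = contradiction uv ¬uv
    path₂-shortest _   _   _ _ (_ ∷ _ ∷ _) = s≤s (s≤s z≤n)

    visible≤2⇒visible : ∀ {X u v} → Visible≤2 X u v → Visible E X u v
    visible≤2⇒visible (inj₁ refl)     = [] , (λ _ → z≤n) , []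
    visible≤2⇒visible (inj₂ (inj₁ e)) = (e ∷ []) , edge-shortest e , []
    visible≤2⇒visible {u = u} {v} (inj₂ (inj₂ (_ , e , e′ , w∉X))) with u ≟ᶠ v | E? u v
    ... | yes refl | _      = [] , (λ _ → z≤n) , []
    ... | no _     | yes uv = (uv ∷ []) , edge-shortest uv , []
    ... | no u≢v   | no ¬uv = (e ∷ e′ ∷ []) , path₂-shortest u≢v ¬uv e e′ , w∉X ∷ []

  Requires : Requirement → Subset n → Set
  Requires R X = ∀ u v → T (R (lookup X u) (lookup X v)) → Visible E X u v

  mutual⇒requires : ∀ {X} → MutualVis E X → Requires inIn X
  mutual⇒requires {X} vis u v r with lookup X u in u∈X | lookup X v in v∈X
  ... | true  | true  = vis u v (lookup⇒[]= u X u∈X) (lookup⇒[]= v X v∈X)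
  ... | true  | false = ⊥-elim r
  ... | false | _     = ⊥-elim r

  outer⇒requires : ∀ {X} → OuterMutualVis E X → Requires inAny X
  outer⇒requires {X} (vis , visOut) u v r with lookup X u in u∈X | lookup X v in v∈X
  ... | true  | true  = vis u v (lookup⇒[]= u X u∈X) (lookup⇒[]= v X v∈X)
  ... | true  | false = visOut u v (lookup⇒[]= u X u∈X) (lookup≡false⇒∉ v∈X)
  ... | false | _     = ⊥-elim r

  dual⇒requires : ∀ {X} → DualMutualVis E X → Requires sameSide X
  dual⇒requires {X} (vis , visOut) u v r with lookup X u in u∈X | lookup X v in v∈X
  ... | true  | true  = vis u v (lookup⇒[]= u X u∈X) (lookup⇒[]= v X v∈X)
  ... | false | false = visOut u v (lookup≡false⇒∉ u∈X) (lookup≡false⇒∉ v∈X)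
  ... | true  | false = ⊥-elim r
  ... | false | true  = ⊥-elim r

  total⇒requires : ∀ {X} → TotalMutualVis E X → Requires anyPair X
  total⇒requires vis u v _ = vis u v

  requires⇒mutual : ∀ {X} → Requires inIn X → MutualVis E X
  requires⇒mutual req u v u∈X v∈X =
    req u v (subst₂ (λ x y → T (x ∧ y)) (sym ([]=⇒lookup u∈X)) (sym ([]=⇒lookup v∈X)) tt)

  requires⇒outer : ∀ {X} → Requires inAny X → OuterMutualVis E X
  requires⇒outer {X} req = (λ u v u∈X _ → fromIn u v u∈X) , (λ u v u∈X _ → fromIn u v u∈X)
    where
    fromIn : ∀ u v → u ∈ X → Visible E X u v
    fromIn u v u∈X = req u v (subst T (sym ([]=⇒lookup u∈X)) tt)

  requires⇒dual : ∀ {X} → Requires sameSide X → DualMutualVis E X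
  requires⇒dual {X} req =
      (λ u v u∈X v∈X → fromSameSide u v ([]=⇒lookup u∈X) ([]=⇒lookup v∈X))
    , (λ u v u∉X v∉X → fromSameSide u v (∉⇒lookup≡false u∉X) (∉⇒lookup≡false v∉X))
    where
    fromSameSide : ∀ u v {b} → lookup X u ≡ b → lookup X v ≡ b → Visible E X u v
    fromSameSide u v {true}  u∈ v∈ = req u v (subst₂ (λ x y → T (sameSide x y)) (sym u∈) (sym v∈) tt)
    fromSameSide u v {false} u∉ v∉ = req u v (subst₂ (λ x y → T (sameSide x y)) (sym u∉) (sym v∉) tt)

  requires⇒total : ∀ {X} → Requires anyPair X → TotalMutualVis E X
  requires⇒total req u v = req u v tt

-- Blow-ups: every vertex t of a graph H replaced by a class ι⁻¹(t) of twins

module Kinds {m : ℕ} (H : Fin m → Fin m → Set) (H? : ∀ s t → Dec (H s t))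
             (H-irreflexive : ∀ t → ¬ H t t)
             (H-reach : ∀ s t → H s t ⊎ ∃ λ r → H s r × H r t) where

  -- F stands for the full kinds: only a middle kind outside F offers a vertex outside X
  KindSee : Subset m → Fin m → Fin m → Set
  KindSee F s t = H s t ⊎ ∃ λ r → H s r × H r t × r ∉ F

  kindSee? : ∀ F s t → Dec (KindSee F s t)
  kindSee? F s t = H? s t ⊎-dec any? λ r → H? s r ×-dec H? r t ×-dec ¬? (r ∈? F)

  KindCondition : Requirement → Subset m → Set
  KindCondition R F = ∀ s t → T (R (lookup F s) (lookup F t)) → s ≡ t ⊎ KindSee F s t

  kindCondition? : ∀ R F → Dec (KindCondition R F)
  kindCondition? R F = all? λ s → all? λ t →
    T? (R (lookup F s) (lookup F t)) →-dec (s ≟ᶠ t ⊎-dec kindSee? F s t)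

  SeesFull : Subset m → Fin m → Set
  SeesFull F s = ∀ t → t ∈ F → s ≡ t ⊎ KindSee F s t

  seesFull? : ∀ F s → Dec (SeesFull F s)
  seesFull? F s = all? λ t → t ∈? F →-dec (s ≟ᶠ t ⊎-dec kindSee? F s t)

  module BlowUp {n : ℕ} {E : Fin n → Fin n → Set} (ι : Fin n → Fin m) (σ : Fin m → Fin n)
                (ι∘σ : ∀ t → ι (σ t) ≡ t) (E⇔H : ∀ {x y} → E x y ⇔ H (ι x) (ι y)) where

    open Visibility E
    open Equivalence

    into-σ : ∀ {u t} → H (ι u) t → E u (σ t)
    into-σ {u} h = from E⇔H (subst (H (ι u)) (sym (ι∘σ _)) h)

    out-of-σ : ∀ {t v} → H t (ι v) → E (σ t) v
    out-of-σ {v = v} h = from E⇔H (subst (λ s → H s (ι v)) (sym (ι∘σ _)) h)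

    E-irreflexive : ∀ x → ¬ E x x
    E-irreflexive x = H-irreflexive (ι x) ∘ to E⇔H

    E? : ∀ x y → Dec (E x y)
    E? x y = map′ (from E⇔H) (to E⇔H) (H? (ι x) (ι y))

    E-diameter≤2 : ∀ u v → Σ (Walk E u v) λ p → len E p ≤ 2
    E-diameter≤2 u v with H-reach (ι u) (ι v)
    ... | inj₁ h           = (from E⇔H h ∷ []) , s≤s z≤n
    ... | inj₂ (_ , h , h′) = (into-σ h ∷ out-of-σ h′ ∷ []) , s≤s (s≤s z≤n)

    Missing : Subset n → Fin m → Set
    Missing X t = ∃ λ x → ι x ≡ t × x ∉ X

    missing? : ∀ X t → Dec (Missing X t)
    missing? X t = any? λ x → ι x ≟ᶠ t ×-dec ¬? (x ∈? X)

    fullKinds : Subset n → Subset m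
    fullKinds X = tabulate λ t → not (does (missing? X t))

    rep : Subset n → Fin m → Fin n
    rep X t with missing? X t
    ... | yes (x , _) = x
    ... | no _        = σ t

    ι∘rep : ∀ X t → ι (rep X t) ≡ t
    ι∘rep X t with missing? X t
    ... | yes (_ , ιx≡t , _) = ιx≡t
    ... | no _               = ι∘σ t

    lookup-rep : ∀ X t → lookup X (rep X t) ≡ lookup (fullKinds X) t
    lookup-rep X t rewrite lookup∘tabulate (λ t → not (does (missing? X t))) t with missing? X t
    ... | yes (_ , _ , x∉X) = ∉⇒lookup≡false x∉X
    ... | no ¬missing with lookup X (σ t) in σt∈X
    ...   | true  = refl
    ...   | false = contradiction (σ t , ι∘σ t , lookup≡false⇒∉ σt∈X) ¬missing

    rep-injective : ∀ X → Injective _≡_ _≡_ (rep X)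
    rep-injective X {s} {t} eq = trans (sym (ι∘rep X s)) (trans (cong ι eq) (ι∘rep X t))

    rep∉ : ∀ {X t} → t ∉ fullKinds X → rep X t ∉ X
    rep∉ {X} {t} t∉F = lookup≡false⇒∉ (trans (lookup-rep X t) (∉⇒lookup≡false t∉F))

    ∉⇒kind∉fullKinds : ∀ {X w} → w ∉ X → ι w ∉ fullKinds X
    ∉⇒kind∉fullKinds {X} {w} w∉X = lookup≡false⇒∉
      (trans (lookup∘tabulate _ (ι w)) (cong not (dec-true (missing? X (ι w)) (w , refl , w∉X))))

    kinds+∣X∣≤n+∣fullKinds∣ : ∀ X → m + ∣ X ∣ ≤ n + ∣ fullKinds X ∣
    kinds+∣X∣≤n+∣fullKinds∣ X = begin
      m + ∣ X ∣                      ≡⟨ cong (_+ ∣ X ∣) (sym (∣p∣+∣∁p∣≡n F)) ⟩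
      ∣ F ∣ + ∣ ∁ F ∣ + ∣ X ∣          ≤⟨ +-monoˡ-≤ ∣ X ∣ (+-monoʳ-≤ ∣ F ∣ ∣∁F∣≤∣∁X∣) ⟩
      ∣ F ∣ + ∣ ∁ X ∣ + ∣ X ∣          ≡⟨ +-assoc ∣ F ∣ _ _ ⟩
      ∣ F ∣ + (∣ ∁ X ∣ + ∣ X ∣)        ≡⟨ cong (∣ F ∣ +_) (trans (+-comm _ ∣ X ∣) (∣p∣+∣∁p∣≡n X)) ⟩
      ∣ F ∣ + n                      ≡⟨ +-comm ∣ F ∣ n ⟩
      n + ∣ F ∣                      ∎
      where
      open ≤-Reasoning
      F = fullKinds X
      ∣∁F∣≤∣∁X∣ : ∣ ∁ F ∣ ≤ ∣ ∁ X ∣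
      ∣∁F∣≤∣∁X∣ = injective⇒∣p∣≤∣q∣ (rep X) (rep-injective X) (x∉p⇒x∈∁p ∘ rep∉ ∘ x∈∁p⇒x∉p)

    visible⇒kindSee : ∀ {X u v} → Visible E X u v → u ≡ v ⊎ KindSee (fullKinds X) (ι u) (ι v)
    visible⇒kindSee vis with visible⇒visible≤2 E-diameter≤2 vis
    ... | inj₁ u≡v                      = inj₁ u≡v
    ... | inj₂ (inj₁ e)                 = inj₂ (inj₁ (to E⇔H e))
    ... | inj₂ (inj₂ (w , e , e′ , w∉X)) =
      inj₂ (inj₂ (ι w , to E⇔H e , to E⇔H e′ , ∉⇒kind∉fullKinds w∉X))

    kindSee⇒visible : ∀ {F X u v} → (∀ t → t ∉ F → σ t ∉ X) → KindSee F (ι u) (ι v) → Visible E X u v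
    kindSee⇒visible _ (inj₁ h) =
      visible≤2⇒visible E-irreflexive E? (inj₂ (inj₁ (from E⇔H h)))
    kindSee⇒visible σ∉X (inj₂ (t , h , h′ , t∉F)) =
      visible≤2⇒visible E-irreflexive E? (inj₂ (inj₂ (σ t , into-σ h , out-of-σ h′ , σ∉X t t∉F)))

    requires⇒kindCondition : ∀ {R X} → Requires R X → KindCondition R (fullKinds X)
    requires⇒kindCondition {R} {X} req s t r
      with visible⇒kindSee (req (rep X s) (rep X t)
             (subst₂ (λ x y → T (R x y)) (sym (lookup-rep X s)) (sym (lookup-rep X t)) r))
    ... | inj₁ eq  = inj₁ (rep-injective X eq)
    ... | inj₂ see = inj₂ (subst₂ (KindSee _) (ι∘rep X s) (ι∘rep X t) see)

    mutual⇒seesFull : ∀ {X x} → MutualVis E X → x ∈ X → SeesFull (fullKinds X) (ι x)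
    mutual⇒seesFull {X} {x} vis x∈X t t∈F
      with visible⇒kindSee (vis x (rep X t) x∈X
             (lookup⇒[]= _ X (trans (lookup-rep X t) ([]=⇒lookup t∈F))))
    ... | inj₁ eq  = inj₁ (trans (cong ι eq) (ι∘rep X t))
    ... | inj₂ see = inj₂ (subst (KindSee _ (ι x)) (ι∘rep X t) see)

kAdj? : ∀ K K′ → Dec (KAdj K K′)
kAdj? (a ℓ) (a ℓ′) = ¬? (ℓ ≟ᶠ ℓ′)
kAdj? (a ℓ) (b ℓ′) = ℓ ≟ᶠ ℓ′
kAdj? (b ℓ) (a ℓ′) = ℓ ≟ᶠ ℓ′
kAdj? (b _) c      = yes tt
kAdj? c     (b _)  = yes tt
kAdj? (a _) c      = no λ ()
kAdj? (b _) (b _)  = no λ ()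
kAdj? c     (a _)  = no λ ()
kAdj? c     c      = no λ ()

kAdj-irreflexive : ∀ K → ¬ KAdj K K
kAdj-irreflexive (a ℓ) ℓ≢ℓ = ℓ≢ℓ refl
kAdj-irreflexive (b ℓ) ()
kAdj-irreflexive c     ()

G₇ : Fin 7 → Fin 7 → Set
G₇ s t = KAdj (baseKind s) (baseKind t)

G₇? : ∀ s t → Dec (G₇ s t)
G₇? s t = kAdj? (baseKind s) (baseKind t)

G₇-reach : ∀ s t → G₇ s t ⊎ ∃ λ r → G₇ s r × G₇ r t
G₇-reach = from-yes (all? λ s → all? λ t → G₇? s t ⊎-dec any? λ r → G₇? s r ×-dec G₇? r t)

open Kinds G₇ G₇? (kAdj-irreflexive ∘ baseKind) G₇-reach

triangle : Subset 7
triangle = inside ∷ inside ∷ inside ∷ outside ∷ outside ∷ outside ∷ outside ∷ []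

c₇ : Fin 7
c₇ = # 6

fullKinds-total : ∀ F → KindCondition anyPair F → ∣ F ∣ ≤ 0
fullKinds-total = from-yes (allSubsets? λ F → kindCondition? anyPair F →-dec ∣ F ∣ ≤? 0)

fullKinds-outer : ∀ F → KindCondition inAny F → ∣ F ∣ ≤ 3
fullKinds-outer = from-yes (allSubsets? λ F → kindCondition? inAny F →-dec ∣ F ∣ ≤? 3)

fullKinds-mutual : ∀ F → KindCondition inIn F → ∣ F ∣ ≤ 4
fullKinds-mutual = from-yes (allSubsets? λ F → kindCondition? inIn F →-dec ∣ F ∣ ≤? 4)

fullKinds-dual : ∀ F → KindCondition sameSide F → ∣ F ∣ ≤ 2 ⊎ F ≡ triangle
fullKinds-dual = from-yes (allSubsets? λ F →
  kindCondition? sameSide F →-dec (∣ F ∣ ≤? 2 ⊎-dec ≡-dec _≟_ F triangle))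

seesFull-triangle : ∀ s → SeesFull triangle s → s ∈ triangle ⊎ s ≡ c₇
seesFull-triangle = from-yes (all? λ s → seesFull? triangle s →-dec (s ∈? triangle ⊎-dec s ≟ᶠ c₇))

-- base t is the vertex t of G₇, copy ℓ the added twins of b_ℓ
data Class : Set where
  base : Fin 7 → Class
  copy : Fin 3 → Class

classKind : Class → Fin 7
classKind (base t)                = t
classKind (copy zero)             = # 3
classKind (copy (suc zero))       = # 4
classKind (copy (suc (suc zero))) = # 5

classKind≡c₇ : ∀ p → classKind p ≡ c₇ → p ≡ base c₇
classKind≡c₇ (base _) refl = refl
classKind≡c₇ (copy zero) ()
classKind≡c₇ (copy (suc zero)) ()
classKind≡c₇ (copy (suc (suc zero))) ()

allClasses? : ∀ {ℓ} {P : Pred Class ℓ} → Decidable P → Dec (∀ p → P p)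
allClasses? P? = map′ (λ (onBase , onCopy) → λ { (base t) → onBase t ; (copy ℓ) → onCopy ℓ })
                      (λ ∀P → ∀P ∘ base , ∀P ∘ copy)
                      (all? (P? ∘ base) ×-dec all? (P? ∘ copy))

baseSet : (Class → Bool) → Subset 7
baseSet f = tabulate (f ∘ base)

ClassCondition : Requirement → (Class → Bool) → Set
ClassCondition R f = ∀ p q → T (R (f p) (f q)) → KindSee (baseSet f) (classKind p) (classKind q)

classCondition? : ∀ R f → Dec (ClassCondition R f)
classCondition? R f = allClasses? λ p → allClasses? λ q →
  T? (R (f p) (f q)) →-dec kindSee? (baseSet f) (classKind p) (classKind q)

withCopies : Subset 7 → Class → Bool
withCopies B (base t) = lookup B t
withCopies B (copy _) = true

-- The vertices of G₇ (in the order a₁ a₂ a₃ b₁ b₂ b₃ c) in the extremal sets, which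
-- moreover contain all the added copies.
totalBase outerBase dualBase mutualBase : Subset 7
totalBase  = outside ∷ outside ∷ outside ∷ outside ∷ outside ∷ outside ∷ outside ∷ []
outerBase  = outside ∷ outside ∷ outside ∷ inside  ∷ inside  ∷ inside  ∷ outside ∷ []
dualBase   = inside  ∷ outside ∷ outside ∷ inside  ∷ outside ∷ outside ∷ outside ∷ []
mutualBase = inside  ∷ outside ∷ outside ∷ inside  ∷ inside  ∷ inside  ∷ outside ∷ []

triangleClasses : Class → Bool
triangleClasses = lookup triangle ∘ classKind

total-sees : ClassCondition anyPair (withCopies totalBase)
total-sees = from-yes (classCondition? anyPair (withCopies totalBase))

outer-sees : ClassCondition inAny (withCopies outerBase)
outer-sees = from-yes (classCondition? inAny (withCopies outerBase))

dual-sees : ClassCondition sameSide (withCopies dualBase)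
dual-sees = from-yes (classCondition? sameSide (withCopies dualBase))

mutual-sees : ClassCondition inIn (withCopies mutualBase)
mutual-sees = from-yes (classCondition? inIn (withCopies mutualBase))

triangle-sees : ClassCondition sameSide triangleClasses
triangle-sees = from-yes (classCondition? sameSide triangleClasses)

[m+i+j+k]≡m+[i+j+k] : ∀ m i j k → m + i + j + k ≡ m + (i + j + k)
[m+i+j+k]≡m+[i+j+k] m i j k =
  trans (+-assoc (m + i) j k) (trans (+-assoc m i (j + k)) (cong (m +_) (sym (+-assoc i j k))))

-- G₇^(i,j,k) as a blow-up of G₇

module Vertices (i j k : ℕ) where

  classOf : Fin (7 + i + j + k) → Class
  classOf x with splitAt (7 + i + j) x
  ... | inj₂ _ = copy (# 2)
  ... | inj₁ y with splitAt (7 + i) y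
  ...   | inj₂ _ = copy (# 1)
  ...   | inj₁ z with splitAt 7 z
  ...     | inj₂ _ = copy (# 0)
  ...     | inj₁ t = base t

  ι : Fin (7 + i + j + k) → Fin 7
  ι = classKind ∘ classOf

  σ : Fin 7 → Fin (7 + i + j + k)
  σ t = ((t ↑ˡ i) ↑ˡ j) ↑ˡ k

  classOf∘σ : ∀ t → classOf (σ t) ≡ base t
  classOf∘σ t
    rewrite splitAt-↑ˡ (7 + i + j) ((t ↑ˡ i) ↑ˡ j) k | splitAt-↑ˡ (7 + i) (t ↑ˡ i) j | splitAt-↑ˡ 7 t i
    = refl

  classOf≡base⇒≡σ : ∀ x {t} → classOf x ≡ base t → x ≡ σ t
  classOf≡base⇒≡σ x eq with splitAt (7 + i + j) x in split₁
  ... | inj₂ _ with () ← eq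
  ... | inj₁ y with splitAt (7 + i) y in split₂
  ...   | inj₂ _ with () ← eq
  ...   | inj₁ z with splitAt 7 z in split₃
  ...     | inj₂ _ with () ← eq
  ...     | inj₁ t with refl ← eq = begin
    x                   ≡⟨ sym (splitAt⁻¹-↑ˡ split₁) ⟩
    y ↑ˡ k              ≡⟨ cong (_↑ˡ k) (sym (splitAt⁻¹-↑ˡ split₂)) ⟩
    (z ↑ˡ j) ↑ˡ k       ≡⟨ cong (λ z → (z ↑ˡ j) ↑ˡ k) (sym (splitAt⁻¹-↑ˡ split₃)) ⟩
    σ t                 ∎
    where open ≡-Reasoning

  ι≡c₇⇒≡σc₇ : ∀ x → ι x ≡ c₇ → x ≡ σ c₇
  ι≡c₇⇒≡σc₇ x ιx≡c₇ = classOf≡base⇒≡σ x (classKind≡c₇ (classOf x) ιx≡c₇)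

  baseKind∘ι : ∀ x → baseKind (ι x) ≡ kind i j k x
  baseKind∘ι x with splitAt (7 + i + j) x
  ... | inj₂ _ = refl
  ... | inj₁ y with splitAt (7 + i) y
  ...   | inj₂ _ = refl
  ...   | inj₁ z with splitAt 7 z
  ...     | inj₂ _ = refl
  ...     | inj₁ t = refl

  G7⇔G₇ : ∀ {x y} → G7 i j k x y ⇔ G₇ (ι x) (ι y)
  G7⇔G₇ {x} {y} = mk⇔ (subst₂ KAdj (sym (baseKind∘ι x)) (sym (baseKind∘ι y)))
                      (subst₂ KAdj (baseKind∘ι x) (baseKind∘ι y))

  classSet₁ : (Class → Bool) → Subset (7 + i)
  classSet₁ f = baseSet f ++ replicate i (f (copy (# 0)))

  classSet₂ : (Class → Bool) → Subset (7 + i + j)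
  classSet₂ f = classSet₁ f ++ replicate j (f (copy (# 1)))

  classSet : (Class → Bool) → Subset (7 + i + j + k)
  classSet f = classSet₂ f ++ replicate k (f (copy (# 2)))

  lookup-classSet : ∀ f x → lookup (classSet f) x ≡ f (classOf x)
  lookup-classSet f x
    rewrite lookup-splitAt (7 + i + j) (classSet₂ f) (replicate k (f (copy (# 2)))) x
    with splitAt (7 + i + j) x
  ... | inj₂ y = lookup-replicate y _
  ... | inj₁ y rewrite lookup-splitAt (7 + i) (classSet₁ f) (replicate j (f (copy (# 1)))) y
    with splitAt (7 + i) y
  ...   | inj₂ z = lookup-replicate z _
  ...   | inj₁ z rewrite lookup-splitAt 7 (baseSet f) (replicate i (f (copy (# 0)))) z
    with splitAt 7 z
  ...     | inj₂ t = lookup-replicate t _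
  ...     | inj₁ t = lookup∘tabulate (f ∘ base) t

  ∣classSet∣ : ∀ f → ∣ classSet f ∣ ≡ ∣ baseSet f ∣ + ∣ replicate i (f (copy (# 0))) ∣
                                   + ∣ replicate j (f (copy (# 1))) ∣ + ∣ replicate k (f (copy (# 2))) ∣
  ∣classSet∣ f
    rewrite ∣p++q∣≡∣p∣+∣q∣ (classSet₂ f) (replicate k (f (copy (# 2))))
          | ∣p++q∣≡∣p∣+∣q∣ (classSet₁ f) (replicate j (f (copy (# 1))))
          | ∣p++q∣≡∣p∣+∣q∣ (baseSet f) (replicate i (f (copy (# 0))))
    = refl

  ∣classSet-withCopies∣ : ∀ B → ∣ classSet (withCopies B) ∣ ≡ i + j + k + ∣ B ∣
  ∣classSet-withCopies∣ B = begin
    ∣ classSet (withCopies B) ∣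
      ≡⟨ ∣classSet∣ (withCopies B) ⟩
    ∣ tabulate (lookup B) ∣ + ∣ ⊤ {i} ∣ + ∣ ⊤ {j} ∣ + ∣ ⊤ {k} ∣
      ≡⟨ cong₂ _+_ (cong₂ _+_ (cong₂ _+_ (cong ∣_∣ (tabulate∘lookup B)) (∣⊤∣≡n i)) (∣⊤∣≡n j)) (∣⊤∣≡n k) ⟩
    ∣ B ∣ + i + j + k
      ≡⟨ [m+i+j+k]≡m+[i+j+k] ∣ B ∣ i j k ⟩
    ∣ B ∣ + (i + j + k)
      ≡⟨ +-comm ∣ B ∣ (i + j + k) ⟩
    i + j + k + ∣ B ∣
      ∎
    where open ≡-Reasoning

  ∣triangleClasses∣ : ∣ classSet triangleClasses ∣ ≡ 3
  ∣triangleClasses∣ rewrite ∣classSet∣ triangleClasses | ∣⊥∣≡0 i | ∣⊥∣≡0 j | ∣⊥∣≡0 k = refl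

  open Visibility (G7 i j k)
  open BlowUp ι σ (cong classKind ∘ classOf∘σ) (λ {x y} → G7⇔G₇ {x} {y})

  ∣X∣≤S+∣fullKinds∣ : ∀ X → ∣ X ∣ ≤ i + j + k + ∣ fullKinds X ∣
  ∣X∣≤S+∣fullKinds∣ X =
    +-cancelˡ-≤ 7 ∣ X ∣ (i + j + k + ∣ F ∣) (subst (7 + ∣ X ∣ ≤_) n+∣F∣≡7+[S+∣F∣] (kinds+∣X∣≤n+∣fullKinds∣ X))
    where
    F = fullKinds X
    n+∣F∣≡7+[S+∣F∣] : 7 + i + j + k + ∣ F ∣ ≡ 7 + (i + j + k + ∣ F ∣)
    n+∣F∣≡7+[S+∣F∣] = trans (cong (_+ ∣ F ∣) ([m+i+j+k]≡m+[i+j+k] 7 i j k)) (+-assoc 7 (i + j + k) ∣ F ∣)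

  bound-by-kinds : ∀ {R X d} → (∀ F → KindCondition R F → ∣ F ∣ ≤ d) → Requires R X →
                   ∣ X ∣ ≤ i + j + k + d
  bound-by-kinds {R} {X} kinds req = ≤-trans (∣X∣≤S+∣fullKinds∣ X)
    (+-monoʳ-≤ (i + j + k) (kinds (fullKinds X) (requires⇒kindCondition {R} {X} req)))

  classCondition⇒requires : ∀ {R f} → ClassCondition R f → Requires R (classSet f)
  classCondition⇒requires {R} {f} sees u v r = kindSee⇒visible σ∉classSet
    (sees (classOf u) (classOf v) (subst₂ (λ x y → T (R x y)) (lookup-classSet f u) (lookup-classSet f v) r))
    where
    σ∉classSet : ∀ t → t ∉ baseSet f → σ t ∉ classSet f
    σ∉classSet t t∉B = lookup≡false⇒∉ (begin
      lookup (classSet f) (σ t)  ≡⟨ lookup-classSet f (σ t) ⟩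
      f (classOf (σ t))          ≡⟨ cong f (classOf∘σ t) ⟩
      f (base t)                 ≡⟨ sym (lookup∘tabulate (f ∘ base) t) ⟩
      lookup (baseSet f) t       ≡⟨ ∉⇒lookup≡false t∉B ⟩
      false                      ∎)
      where open ≡-Reasoning

  maxCard-by-kinds : ∀ {P : Subset (7 + i + j + k) → Set} R B →
                     (∀ {X} → P X → Requires R X) → (∀ {X} → Requires R X → P X) →
                     (∀ F → KindCondition R F → ∣ F ∣ ≤ ∣ B ∣) → ClassCondition R (withCopies B) →
                     IsMaxCard P (i + j + k + ∣ B ∣)
  maxCard-by-kinds R B P⇒R R⇒P kinds sees =
      (classSet (withCopies B) , R⇒P (classCondition⇒requires {R} sees) , ∣classSet-withCopies∣ B)
    , λ X PX → bound-by-kinds {R} kinds (P⇒R PX)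

  triangle-bound : ∀ {X} → MutualVis (G7 i j k) X → fullKinds X ≡ triangle → ∣ X ∣ ≤ 3
  triangle-bound {X} vis F≡△ = ≤-trans (p⊆q⇒∣p∣≤∣q∣ X⊆△) (≤-reflexive ∣triangleClasses∣)
    where
    c₇∉F : c₇ ∉ fullKinds X
    c₇∉F = subst (c₇ ∉_) (sym F≡△) (lookup≡false⇒∉ {X = triangle} refl)
    -- the vertex of kind c₇ is unique, and some vertex of that kind lies outside X
    kind≢c₇ : ∀ {x} → x ∈ X → ι x ≢ c₇
    kind≢c₇ {x} x∈X ιx≡c₇ = rep∉ {X} {c₇} c₇∉F (subst (_∈ X) x≡rep x∈X)
      where
      x≡rep : x ≡ rep X c₇
      x≡rep = trans (ι≡c₇⇒≡σc₇ x ιx≡c₇) (sym (ι≡c₇⇒≡σc₇ (rep X c₇) (ι∘rep X c₇)))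
    kind∈△ : ∀ {x} → x ∈ X → ι x ∈ triangle
    kind∈△ {x} x∈X = [ id , (λ ιx≡c₇ → contradiction ιx≡c₇ (kind≢c₇ x∈X)) ]′
      (seesFull-triangle (ι x) (subst (λ F → SeesFull F (ι x)) F≡△ (mutual⇒seesFull {X} {x} vis x∈X)))
    X⊆△ : X ⊆ classSet triangleClasses
    X⊆△ {x} x∈X = lookup⇒[]= x (classSet triangleClasses)
      (trans (lookup-classSet triangleClasses x) ([]=⇒lookup (kind∈△ x∈X)))

  dual-bound : ∀ {X} → DualMutualVis (G7 i j k) X → ∣ X ∣ ≤ i + j + k + 2 ⊎ ∣ X ∣ ≤ 3
  dual-bound {X} vis = Sum.map
    (λ ∣F∣≤2 → ≤-trans (∣X∣≤S+∣fullKinds∣ X) (+-monoʳ-≤ (i + j + k) ∣F∣≤2))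
    (triangle-bound (proj₁ vis))
    (fullKinds-dual (fullKinds X) (requires⇒kindCondition {sameSide} {X} (dual⇒requires vis)))

  dual-maxCard₀ : i + j + k ≡ 0 → IsMaxCard (DualMutualVis (G7 i j k)) 3
  dual-maxCard₀ S≡0 =
      ( classSet triangleClasses
      , requires⇒dual (classCondition⇒requires {sameSide} {triangleClasses} triangle-sees)
      , ∣triangleClasses∣)
    , λ X vis → [ (λ ∣X∣≤S+2 → ≤-trans ∣X∣≤S+2 (≤-trans (≤-reflexive (cong (_+ 2) S≡0)) (n≤1+n 2))) , id ]′
                (dual-bound vis)

  dual-maxCard₁ : 1 ≤ i + j + k → IsMaxCard (DualMutualVis (G7 i j k)) (i + j + k + 2)
  dual-maxCard₁ 1≤S =
      ( classSet (withCopies dualBase)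
      , requires⇒dual (classCondition⇒requires {sameSide} {withCopies dualBase} dual-sees)
      , ∣classSet-withCopies∣ dualBase)
    , λ X vis → [ id , (λ ∣X∣≤3 → ≤-trans ∣X∣≤3 (+-monoˡ-≤ 2 1≤S)) ]′ (dual-bound vis)

proposition5p5 : (i j k : ℕ) →
    IsMaxCard (TotalMutualVis (G7 i j k)) (i + j + k)
    × IsMaxCard (OuterMutualVis (G7 i j k)) (i + j + k + 3)
    × (i + j + k ≡ 0 → IsMaxCard (DualMutualVis (G7 i j k)) 3)
    × (1 ≤ i + j + k → IsMaxCard (DualMutualVis (G7 i j k)) (i + j + k + 2))
    × IsMaxCard (MutualVis (G7 i j k)) (i + j + k + 4)
proposition5p5 i j k =
    subst (IsMaxCard _) (+-identityʳ (i + j + k))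
      (maxCard-by-kinds anyPair totalBase total⇒requires requires⇒total fullKinds-total total-sees)
  , maxCard-by-kinds inAny outerBase outer⇒requires requires⇒outer fullKinds-outer outer-sees
  , dual-maxCard₀
  , dual-maxCard₁
  , maxCard-by-kinds inIn mutualBase mutual⇒requires requires⇒mutual fullKinds-mutual mutual-sees
  where
  open Vertices i j k
  open Visibility (G7 i j k)
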